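{- Let $G$ be a directed graph, let $s,t\in V(G)$, and let $F$ be a feedback edge set of the underlying undirected graph $U$ of $G$ (i.e. $U-F$ is a forest), of size $f:=|F|$. Then the number of simple directed $s$-$t$ paths in $G$ is at most \[ N(f):=\sum_{r=0}^{f}\binom{f}{r}\,r!\,2^r\ \le\ (2f+1)^f. \] Moreover, every simple $s$-$t$ path is uniquely determined by the ordered list of edges of $F$ it uses (in the order they occur along the path) together with the directions in which it traverses them.
   Context: The underlying undirected graph $U$ of $G$ has vertex set $V(G)$ and an edge $\{x,y\}$ whenever $(x,y)\in E(G)$ or $(y,x)\in E(G)$. A path uses an edge $\{x,y\}\in F$ if it traverses $(x,y)$ or $(y,x)$. -}

module Defs where

open import Data.Nat using (ℕ; suc; _+_; _*_; _^_; _≤_; _!)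
open import Data.Nat.ListAction using (sum)
open import Data.Nat.Combinatorics using (_C_)
open import Data.Fin using (Fin)
import Data.Fin.Properties as FinP
open import Data.Product using (_×_; _,_; Σ; ∃)
open import Data.Product.Properties using (≡-dec)
open import Data.Sum using (_⊎_)
open import Data.Maybe using (just)
open import Data.List using (List; []; _∷_; _++_; [_]; filter; head; last; map; upTo)
open import Data.List.Relation.Unary.Linked using (Linked)
open import Data.List.Relation.Unary.Unique.Propositional using (Unique)
open import Data.List.Membership.Propositional using (_∈_)
import Data.List.Membership.DecPropositional as DecMem
open import Relation.Binary.PropositionalEquality using (_≡_)
open import Relation.Nullary using (¬_; Dec)
open import Relation.Nullary.Decidable using (_⊎-dec_)

Digraph : ℕ → Set₁
Digraph n = Fin n → Fin n → Set

UEdge : ∀ {n} → Digraph n → Fin n → Fin n → Set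
UEdge E x y = E x y ⊎ E y x

-- A finite set of undirected edges, each {x,y} stored as a pair (x , y).
EdgeList : ℕ → Set
EdgeList n = List (Fin n × Fin n)

InF : ∀ {n} → EdgeList n → Fin n → Fin n → Set
InF F x y = (x , y) ∈ F ⊎ (y , x) ∈ F

pair≟ : ∀ {n} (p q : Fin n × Fin n) → Dec (p ≡ q)
pair≟ = ≡-dec FinP._≟_ FinP._≟_

InF? : ∀ {n} (F : EdgeList n) (e : Fin n × Fin n) → Dec (InF F (Data.Product.proj₁ e) (Data.Product.proj₂ e))
InF? F (x , y) = DecMem._∈?_ pair≟ (x , y) F ⊎-dec DecMem._∈?_ pair≟ (y , x) F

-- F is a set of edges of U (no repeated undirected edge), |F| = length F.
IsUEdgeSet : ∀ {n} → Digraph n → EdgeList n → Set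
IsUEdgeSet {n} E F =
  Unique F
  × (∀ (x y : Fin n) → (x , y) ∈ F → UEdge E x y)
  × (∀ (x y : Fin n) → (x , y) ∈ F → (y , x) ∈ F → x ≡ y)

AdjUminusF : ∀ {n} → Digraph n → EdgeList n → Fin n → Fin n → Set
AdjUminusF E F x y = UEdge E x y × ¬ InF F x y

HasCycle : ∀ {n} → (Fin n → Fin n → Set) → Set
HasCycle {n} A =
  (Σ (Fin n) λ x → A x x)
  ⊎ (Σ (Fin n) λ x → Σ (Fin n) λ y → Σ (Fin n) λ z → Σ (List (Fin n)) λ zs →
       Unique (x ∷ y ∷ z ∷ zs) × Linked A ((x ∷ y ∷ z ∷ zs) ++ [ x ]))

IsFeedbackEdgeSet : ∀ {n} → Digraph n → EdgeList n → Set
IsFeedbackEdgeSet E F = IsUEdgeSet E F × ¬ HasCycle (AdjUminusF E F)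

SimplePath : ∀ {n} → Digraph n → Fin n → Fin n → List (Fin n) → Set
SimplePath E s t p = Unique p × Linked E p × head p ≡ just s × last p ≡ just t

steps : ∀ {A : Set} → List A → List (A × A)
steps [] = []
steps (x ∷ []) = []
steps (x ∷ y ∷ xs) = (x , y) ∷ steps (y ∷ xs)

-- The ordered list of F-edges used by the path, each with its traversal
-- direction: (x , y) means {x,y} ∈ F traversed from x to y.
Fsignature : ∀ {n} → EdgeList n → List (Fin n) → List (Fin n × Fin n)
Fsignature F p = filter (InF? F) (steps p)

N : ℕ → ℕ
N f = sum (map (λ r → (f C r) * ((r !) * (2 ^ r))) (upTo (suc f)))

-- Along a simple s–t path, the stretches between consecutive edges of F
-- (and before the first and after the last one) run inside the forest U − F, where a
-- path between two vertices is unique; so the path is determined by its F-signature.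
-- Concretely, if two simple paths with the same signature first diverge at a vertex a,
-- either one of them leaves a through an F-edge (and then the signatures already differ),
-- or both run through U − F to the same vertex, which closes a cycle in U − F.
-- A signature lists distinct edges of F, each in one of two directions. Choosing the
-- first edge and its direction gives N(f+1) = 1 + 2(f+1) N(f) for the number of such
-- lists, and this recursion also yields N(f) ≤ (2f+1)^f.
module Submission where

open import Defs
open import Data.Nat using (ℕ; zero; suc; _+_; _*_; _^_; _≤_; _≤ᵇ_; _!; z≤n; s≤s; s≤s⁻¹)
open import Data.Nat.Properties
open import Data.Nat.ListAction using (sum)
open import Data.Nat.Combinatorics using (_C_; _P_; nCk≡nPk/k!; k>n⇒nCk≡0)
open import Data.Nat.Combinatorics.Base using (_P′_)
open import Data.Nat.Combinatorics.Specification using (nP′k≡n[n∸1P′k∸1]; k!∣nP′k)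
open import Data.Nat.DivMod using (_/_; m/n*n≡m)
open import Data.Nat.Tactic.RingSolver using (solve-∀)
open import Data.Bool using (true)
open import Data.Empty using (⊥; ⊥-elim)
open import Data.Fin using (Fin; zero; suc)
import Data.Fin.Properties as Fin
open import Data.Maybe using (Maybe; just)
open import Data.Maybe.Properties using (just-injective)
open import Data.Product using (_×_; _,_; proj₁; proj₂; ∃; swap; uncurry)
import Data.Product as Product
open import Data.Sum using (_⊎_; inj₁; inj₂)
import Data.Sum as Sum
open import Data.List
  using (List; []; _∷_; [_]; _++_; map; concatMap; length; lookup; removeAt; allFin; upTo; head; last; reverse; reverseAcc)
open import Data.List.Properties
  using (map-applyUpTo; map-cong; map-∘; length-++; length-++-sucʳ; length-map; length-tabulate; length-removeAt′;
         length-reverse; reverse-++; unfold-reverse; ++-assoc; filter-accept; filter-reject; ∷-injectiveˡ; ∷-injectiveʳ)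
open import Data.List.Relation.Unary.All as All using (All; []; _∷_)
import Data.List.Relation.Unary.All.Properties as All
open import Data.List.Relation.Unary.AllPairs using (AllPairs; []; _∷_)
import Data.List.Relation.Unary.AllPairs.Properties as AllPairs
open import Data.List.Relation.Unary.Any using (Any; here; there; index; _─_)
import Data.List.Relation.Unary.Any.Properties as Any
import Data.List.Relation.Unary.First as First
open import Data.List.Relation.Unary.First.Properties using (toView)
open import Data.List.Relation.Unary.Linked using (Linked; []; [-]; _∷_)
open import Data.List.Relation.Unary.Unique.Propositional using (Unique)
import Data.List.Relation.Unary.Unique.Propositional.Properties as Unique
open import Data.List.Membership.Propositional using (_∈_; _∉_; lose)
open import Data.List.Membership.Propositional.Properties
  using (∈-map⁺; ∈-++⁺ˡ; ∈-++⁺ʳ; ∈-∃++; ∈-concatMap⁺; ∈-allFin; ∈-lookup)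
import Data.List.Membership.DecPropositional as DecMembership
open import Function using (_∘_; id)
open import Relation.Binary.PropositionalEquality hiding ([_])
open import Relation.Nullary using (¬_; yes; no)
open import Relation.Nullary.Decidable using (toSum)

-- The number N(f)

nPk≡nP′k : ∀ {n k} → k ≤ n → n P k ≡ n P′ k
nPk≡nP′k {n} {k} k≤n with k ≤ᵇ n | ≤⇒≤ᵇ k≤n
... | true | _ = refl

nCk*k!≡nP′k : ∀ {n k} → k ≤ n → (n C k) * k ! ≡ n P′ k
nCk*k!≡nP′k {n} {k} k≤n = begin
  (n C k) * k !          ≡⟨ cong (_* k !) (nCk≡nPk/k! k≤n) ⟩
  (n P k) / k ! * k !    ≡⟨ cong (λ m → m / k ! * k !) (nPk≡nP′k k≤n) ⟩
  (n P′ k) / k ! * k !   ≡⟨ m/n*n≡m (k!∣nP′k k≤n) ⟩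
  n P′ k                 ∎
  where
  open ≡-Reasoning
  instance _ = k !≢0

[n+1]C[k+1]*[k+1]!≡[n+1]*nCk*k! : ∀ n k → (suc n C suc k) * suc k ! ≡ suc n * ((n C k) * k !)
[n+1]C[k+1]*[k+1]!≡[n+1]*nCk*k! n k with k ≤? n
... | yes k≤n = begin
  (suc n C suc k) * suc k !   ≡⟨ nCk*k!≡nP′k (s≤s k≤n) ⟩
  suc n P′ suc k              ≡⟨ nP′k≡n[n∸1P′k∸1] (suc n) (suc k) ⟩
  suc n * (n P′ k)            ≡⟨ cong (suc n *_) (nCk*k!≡nP′k k≤n) ⟨
  suc n * ((n C k) * k !)     ∎
  where open ≡-Reasoning
... | no k≰n rewrite k>n⇒nCk≡0 (s≤s (≰⇒> k≰n)) | k>n⇒nCk≡0 (≰⇒> k≰n) = sym (*-zeroʳ (suc n))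

N-term : ℕ → ℕ → ℕ
N-term f r = (f C r) * (r ! * 2 ^ r)

N-term-suc : ∀ f r → N-term (suc f) (suc r) ≡ 2 * suc f * N-term f r
N-term-suc f r = begin
  (suc f C suc r) * (suc r ! * 2 ^ suc r)   ≡⟨ *-assoc (suc f C suc r) _ _ ⟨
  (suc f C suc r) * suc r ! * (2 * 2 ^ r)   ≡⟨ cong (_* (2 * 2 ^ r)) ([n+1]C[k+1]*[k+1]!≡[n+1]*nCk*k! f r) ⟩
  suc f * ((f C r) * r !) * (2 * 2 ^ r)     ≡⟨ rearrange (suc f) (f C r) (r !) (2 ^ r) ⟩
  2 * suc f * N-term f r                    ∎
  where
  open ≡-Reasoning
  rearrange : ∀ a b c d → a * (b * c) * (2 * d) ≡ 2 * a * (b * (c * d))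
  rearrange = solve-∀

sum-map-*ˡ : ∀ c (h : ℕ → ℕ) xs → sum (map (λ x → c * h x) xs) ≡ c * sum (map h xs)
sum-map-*ˡ c h []       = sym (*-zeroʳ c)
sum-map-*ˡ c h (x ∷ xs) = trans (cong (c * h x +_) (sum-map-*ˡ c h xs)) (sym (*-distribˡ-+ c (h x) _))

upTo-suc : ∀ m → upTo (suc m) ≡ 0 ∷ map suc (upTo m)
upTo-suc m = cong (0 ∷_) (sym (map-applyUpTo id suc m))

N-suc : ∀ f → N (suc f) ≡ 1 + 2 * suc f * N f
N-suc f = begin
  N (suc f)
    ≡⟨ cong (sum ∘ map (N-term (suc f))) (upTo-suc (suc f)) ⟩
  1 + sum (map (N-term (suc f)) (map suc (upTo (suc f))))
    ≡⟨ cong (λ xs → 1 + sum xs) (map-∘ (upTo (suc f))) ⟨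
  1 + sum (map (N-term (suc f) ∘ suc) (upTo (suc f)))
    ≡⟨ cong (λ xs → 1 + sum xs) (map-cong (N-term-suc f) (upTo (suc f))) ⟩
  1 + sum (map (λ r → 2 * suc f * N-term f r) (upTo (suc f)))
    ≡⟨ cong (1 +_) (sum-map-*ˡ (2 * suc f) (N-term f) (upTo (suc f))) ⟩
  1 + 2 * suc f * N f
    ∎
  where open ≡-Reasoning

N≤[2f+1]^f : ∀ f → N f ≤ (2 * f + 1) ^ f
N≤[2f+1]^f zero    = ≤-refl
N≤[2f+1]^f (suc f) = begin
  N (suc f)                   ≡⟨ N-suc f ⟩
  1 + 2 * suc f * N f         ≤⟨ +-mono-≤ (m^n>0 B f) (*-monoʳ-≤ (2 * suc f) N[f]≤B^f) ⟩
  B ^ f + 2 * suc f * B ^ f   ≡⟨ factor f (B ^ f) ⟩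
  B ^ suc f                   ∎
  where
  open ≤-Reasoning
  B = 2 * suc f + 1
  N[f]≤B^f : N f ≤ B ^ f
  N[f]≤B^f = ≤-trans (N≤[2f+1]^f f) (^-monoˡ-≤ f (+-monoˡ-≤ 1 (*-monoʳ-≤ 2 (n≤1+n f))))
  factor : ∀ f x → x + 2 * suc f * x ≡ (2 * suc f + 1) * x
  factor = solve-∀

module _ {A : Set} where

  lookup-injective : ∀ {xs : List A} → Unique xs → ∀ i j → lookup xs i ≡ lookup xs j → i ≡ j
  lookup-injective (_ ∷ _)    zero    zero    _  = refl
  lookup-injective (x∉ ∷ _)   zero    (suc j) eq = ⊥-elim (All.lookup x∉ (∈-lookup j) eq)
  lookup-injective (x∉ ∷ _)   (suc i) zero    eq = ⊥-elim (All.lookup x∉ (∈-lookup i) (sym eq))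
  lookup-injective (_ ∷ xs!)  (suc i) (suc j) eq = cong suc (lookup-injective xs! i j eq)

  ∈-─ : ∀ {k x : A} {xs} (k∈xs : k ∈ xs) → x ∈ xs → x ≢ k → x ∈ (xs ─ k∈xs)
  ∈-─ (here refl)  (here refl)  x≢k = ⊥-elim (x≢k refl)
  ∈-─ (here refl)  (there x∈xs) _   = x∈xs
  ∈-─ (there _)    (here refl)  _   = here refl
  ∈-─ (there k∈xs) (there x∈xs) x≢k = there (∈-─ k∈xs x∈xs x≢k)

  last-∈ : ∀ {xs : List A} {w} → last xs ≡ just w → w ∈ xs
  last-∈ {x ∷ []}     refl = here refl
  last-∈ {x ∷ y ∷ xs} eq   = there (last-∈ {y ∷ xs} eq)

  last-∷ : ∀ (x : A) xs → ∃ λ w → last (x ∷ xs) ≡ just w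
  last-∷ x []       = x , refl
  last-∷ x (y ∷ xs) = last-∷ y xs

  Unique-++⁻ˡ : ∀ (xs : List A) {ys} → Unique (xs ++ ys) → Unique xs
  Unique-++⁻ˡ []       _            = []
  Unique-++⁻ˡ (x ∷ xs) (x∉ ∷ xsys!) = All.++⁻ˡ xs x∉ ∷ Unique-++⁻ˡ xs xsys!

  Unique-reverse : ∀ {xs : List A} → Unique xs → Unique (reverse xs)
  Unique-reverse {[]}     _ = []
  Unique-reverse {x ∷ xs} (x∉ ∷ xs!) rewrite unfold-reverse x xs =
    Unique.++⁺ (Unique-reverse xs!) ([] ∷ []) λ { (x∈xs , here refl) → All.lookup x∉ (Any.reverse⁻ x∈xs) refl }

  steps-∈ : ∀ (xs : List A) → All (λ e → proj₁ e ∈ xs × proj₂ e ∈ xs) (steps xs)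
  steps-∈ []           = []
  steps-∈ (x ∷ [])     = []
  steps-∈ (x ∷ y ∷ xs) = (here refl , there (here refl)) ∷ All.map (Product.map there there) (steps-∈ (y ∷ xs))

  module _ {R : A → A → Set} where

    Linked-++⁻ˡ : ∀ xs {ys} → Linked R (xs ++ ys) → Linked R xs
    Linked-++⁻ˡ []           _        = []
    Linked-++⁻ˡ (x ∷ [])     _        = [-]
    Linked-++⁻ˡ (x ∷ y ∷ xs) (r ∷ rs) = r ∷ Linked-++⁻ˡ (y ∷ xs) rs

    Linked-glue : ∀ xs {w ys} → Linked R (xs ++ [ w ]) → Linked R (w ∷ ys) → Linked R (xs ++ w ∷ ys)
    Linked-glue []           _        rs′ = rs′
    Linked-glue (x ∷ [])     (r ∷ _)  rs′ = r ∷ rs′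
    Linked-glue (x ∷ y ∷ xs) (r ∷ rs) rs′ = r ∷ Linked-glue (y ∷ xs) rs rs′

    Linked-reverse : (∀ {x y} → R x y → R y x) → ∀ {xs} → Linked R xs → Linked R (reverse xs)
    Linked-reverse R-sym []            = []
    Linked-reverse R-sym rs@[-]        = rs
    Linked-reverse R-sym rs@(_ ∷ _)    = onto rs [-]
      where
      onto : ∀ {x xs acc} → Linked R (x ∷ xs) → Linked R (x ∷ acc) → Linked R (reverseAcc (x ∷ acc) xs)
      onto [-]      racc = racc
      onto (r ∷ rs) racc = onto rs (R-sym r ∷ racc)

module _ {A B : Set} where

  length-concatMap≤ : ∀ {f : A → List B} c → (∀ x → length (f x) ≤ c) → ∀ xs → length (concatMap f xs) ≤ length xs * c
  length-concatMap≤     c bound []       = z≤n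
  length-concatMap≤ {f} c bound (x ∷ xs) = begin
    length (f x ++ concatMap f xs)           ≡⟨ length-++ (f x) ⟩
    length (f x) + length (concatMap f xs)   ≤⟨ +-mono-≤ (bound x) (length-concatMap≤ c bound xs) ⟩
    c + length xs * c                        ∎
    where open ≤-Reasoning

  module _ {Q : A → Set} (f : A → B) (f-injective : ∀ {x y} → Q x → Q y → f x ≡ f y → x ≡ y) where

    injectiveOn⇒length≤ : ∀ {xs ys} → Unique xs → All Q xs → (∀ {x} → Q x → f x ∈ ys) → length xs ≤ length ys
    injectiveOn⇒length≤ {xs} {ys} xs! Qxs f∈ys = Fin.injective⇒≤ position-injective
      where
      Q[_] : ∀ i → Q (lookup xs i)
      Q[ i ] = All.lookup Qxs (∈-lookup i)
      position : Fin (length xs) → Fin (length ys)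
      position i = index (f∈ys Q[ i ])
      position-injective : ∀ {i j} → position i ≡ position j → i ≡ j
      position-injective {i} {j} eq = lookup-injective xs! i j (f-injective Q[ i ] Q[ j ] (begin
        f (lookup xs i)          ≡⟨ Any.lookup-index (f∈ys Q[ i ]) ⟩
        lookup ys (position i)   ≡⟨ cong (lookup ys) eq ⟩
        lookup ys (position j)   ≡⟨ Any.lookup-index (f∈ys Q[ j ]) ⟨
        f (lookup xs j)          ∎))
        where open ≡-Reasoning

-- Oriented selections of edges

module _ {V : Set} where

  _≢ᵘ_ : V × V → V × V → Set
  e ≢ᵘ e′ = e′ ≢ e × swap e′ ≢ e

  ≢ᵘ-swapˡ : ∀ {e e′} → e ≢ᵘ e′ → swap e ≢ᵘ e′
  ≢ᵘ-swapˡ (e′≢e , swap-e′≢e) = (λ eq → swap-e′≢e (cong swap eq)) , (λ eq → e′≢e (cong swap eq))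

  OrientedIn : List (V × V) → V × V → Set
  OrientedIn K e = e ∈ K ⊎ swap e ∈ K

  OrientedIn-─ : ∀ {k e K} (k∈K : k ∈ K) → k ≢ᵘ e → OrientedIn K e → OrientedIn (K ─ k∈K) e
  OrientedIn-─ k∈K (e≢k , swap-e≢k) (inj₁ e∈K)      = inj₁ (∈-─ k∈K e∈K e≢k)
  OrientedIn-─ k∈K (e≢k , swap-e≢k) (inj₂ swap-e∈K) = inj₂ (∈-─ k∈K swap-e∈K swap-e≢k)

  OrientedSelection : List (V × V) → List (V × V) → Set
  OrientedSelection K w = All (OrientedIn K) w × AllPairs _≢ᵘ_ w

  steps-≢ᵘ : ∀ {xs : List V} → Unique xs → AllPairs _≢ᵘ_ (steps xs)
  steps-≢ᵘ {[]}         _                 = []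
  steps-≢ᵘ {x ∷ []}     _                 = []
  steps-≢ᵘ {x ∷ y ∷ xs} xyxs!@(_ ∷ yxs!) = All.map later-step (steps-∈ (y ∷ xs)) ∷ steps-≢ᵘ yxs!
    where
    x∉ : x ∉ y ∷ xs
    x∉ = Unique.Unique[x∷xs]⇒x∉xs xyxs!
    later-step : ∀ {e} → proj₁ e ∈ y ∷ xs × proj₂ e ∈ y ∷ xs → (x , y) ≢ᵘ e
    later-step (∈₁ , ∈₂) = (λ { refl → x∉ ∈₁ }) , (λ { refl → x∉ ∈₂ })

  bothOrientations : V × V → List (List (V × V)) → List (List (V × V))
  bothOrientations k ws = map (k ∷_) ws ++ map (swap k ∷_) ws

  ∈-bothOrientations : ∀ {e k w ws} → e ≡ k ⊎ e ≡ swap k → w ∈ ws → e ∷ w ∈ bothOrientations k ws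
  ∈-bothOrientations           (inj₁ refl) w∈ws = ∈-++⁺ˡ (∈-map⁺ _ w∈ws)
  ∈-bothOrientations {ws = ws} (inj₂ refl) w∈ws = ∈-++⁺ʳ (map _ ws) (∈-map⁺ _ w∈ws)

  length-bothOrientations : ∀ k ws → length (bothOrientations k ws) ≡ 2 * length ws
  length-bothOrientations k ws = begin
    length (map (k ∷_) ws ++ map (swap k ∷_) ws)           ≡⟨ length-++ (map (k ∷_) ws) ⟩
    length (map (k ∷_) ws) + length (map (swap k ∷_) ws)   ≡⟨ cong₂ _+_ (length-map _ ws) (length-map _ ws) ⟩
    length ws + length ws                                  ≡⟨ cong (length ws +_) (+-identityʳ _) ⟨
    2 * length ws                                          ∎
    where open ≡-Reasoning

  -- m is fuel: the enumeration is complete once length K ≤ m.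
  orientedSelections : ℕ → List (V × V) → List (List (V × V))
  orientedSelections zero    K = [ [] ]
  orientedSelections (suc m) K =
    [] ∷ concatMap (λ i → bothOrientations (lookup K i) (orientedSelections m (removeAt K i))) (allFin (length K))

  orientedSelections-complete : ∀ m K w → length K ≤ m → OrientedSelection K w → w ∈ orientedSelections m K
  orientedSelections-complete zero    K  []      _ _                 = here refl
  orientedSelections-complete (suc m) K  []      _ _                 = here refl
  orientedSelections-complete zero    [] (e ∷ w) _ (inj₁ () ∷ _ , _)
  orientedSelections-complete zero    [] (e ∷ w) _ (inj₂ () ∷ _ , _)
  orientedSelections-complete (suc m) K  (e ∷ w) K≤1+m (e∈K ∷ w∈K , e≢ᵘw ∷ w!) = pick e∈K
    where
    extend : ∀ {k} (k∈K : k ∈ K) → e ≡ lookup K (index k∈K) ⊎ e ≡ swap (lookup K (index k∈K)) →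
             All (k ≢ᵘ_) w → e ∷ w ∈ orientedSelections (suc m) K
    extend k∈K e≡k k≢ᵘw =
      there (∈-concatMap⁺ _ (lose (∈-allFin (index k∈K)) (∈-bothOrientations e≡k w∈selections)))
      where
      K─k≤m : length (K ─ k∈K) ≤ m
      K─k≤m = s≤s⁻¹ (subst (_≤ suc m) (length-removeAt′ K (index k∈K)) K≤1+m)
      w∈selections : w ∈ orientedSelections m (K ─ k∈K)
      w∈selections = orientedSelections-complete m (K ─ k∈K) w K─k≤m
        (All.zipWith (uncurry (OrientedIn-─ k∈K)) (k≢ᵘw , w∈K) , w!)
    pick : OrientedIn K e → e ∷ w ∈ orientedSelections (suc m) K
    pick (inj₁ e∈K)      = extend e∈K (inj₁ (Any.lookup-index e∈K)) e≢ᵘw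
    pick (inj₂ swap-e∈K) =
      extend swap-e∈K (inj₂ (cong swap (Any.lookup-index swap-e∈K))) (All.map ≢ᵘ-swapˡ e≢ᵘw)

  length-orientedSelections : ∀ m K → length K ≤ m → length (orientedSelections m K) ≤ N m
  length-orientedSelections zero    K _     = ≤-refl
  length-orientedSelections (suc m) K K≤1+m = begin
    1 + length (concatMap _ (allFin (length K)))
      ≤⟨ +-monoʳ-≤ 1 (length-concatMap≤ (2 * N m) extensions≤ (allFin (length K))) ⟩
    1 + length (allFin (length K)) * (2 * N m)
      ≡⟨ cong (λ l → 1 + l * (2 * N m)) (length-tabulate {n = length K} id) ⟩
    1 + length K * (2 * N m)
      ≤⟨ +-monoʳ-≤ 1 (*-monoˡ-≤ (2 * N m) K≤1+m) ⟩
    1 + suc m * (2 * N m)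
      ≡⟨ cong (1 +_) (trans (sym (*-assoc (suc m) 2 (N m))) (cong (_* N m) (*-comm (suc m) 2))) ⟩
    1 + 2 * suc m * N m
      ≡⟨ N-suc m ⟨
    N (suc m)
      ∎
    where
    open ≤-Reasoning
    extensions≤ : ∀ i → length (bothOrientations (lookup K i) (orientedSelections m (removeAt K i))) ≤ 2 * N m
    extensions≤ i = begin
      length (bothOrientations (lookup K i) (orientedSelections m (removeAt K i)))
        ≡⟨ length-bothOrientations (lookup K i) (orientedSelections m (removeAt K i)) ⟩
      2 * length (orientedSelections m (removeAt K i))
        ≤⟨ *-monoʳ-≤ 2 (length-orientedSelections m (removeAt K i) K─i≤m) ⟩
      2 * N m
        ∎
      where
      K─i≤m : length (removeAt K i) ≤ m
      K─i≤m = s≤s⁻¹ (subst (_≤ suc m) (length-removeAt′ K i) K≤1+m)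

-- Cycles from diverging paths

module _ {n} {A : Fin n → Fin n → Set} (A-sym : ∀ {x y} → A x y → A y x) where

  open DecMembership (Fin._≟_ {n}) using (_∈?_)

  HasCycle-intro : ∀ s T → 2 ≤ length T → Unique (s ∷ T) → Linked A ((s ∷ T) ++ [ s ]) → HasCycle A
  HasCycle-intro s (a ∷ b ∷ T) _        sT! sTs-linked = inj₂ (s , a , b , T , sT! , sTs-linked)
  HasCycle-intro s (a ∷ [])    (s≤s ()) _   _

  first∈-view : ∀ X Y → Any (_∈ X) Y → First.FirstView (_∉ X) (_∈ X) Y
  first∈-view X Y meets with First.first (λ v → Sum.swap (toSum (v ∈? X))) Y
  ... | inj₁ first = toView first
  ... | inj₂ none  = ⊥-elim (All.All¬⇒¬Any none meets)

  -- The cycle goes out along the first path to v and back along the second,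
  -- whose part before v avoids the first path.
  meeting⇒cycle : ∀ s v Xmid Xrest Ymid Yrest →
                  Unique (s ∷ Xmid ++ v ∷ Xrest) → Unique (s ∷ Ymid ++ v ∷ Yrest) →
                  Linked A (s ∷ Xmid ++ v ∷ Xrest) → Linked A (s ∷ Ymid ++ v ∷ Yrest) →
                  All (_∉ Xmid ++ v ∷ Xrest) Ymid → head (Xmid ++ v ∷ Xrest) ≢ head (Ymid ++ v ∷ Yrest) → HasCycle A
  meeting⇒cycle s v Xmid Xrest Ymid Yrest sX! sY!@(_ ∷ Y!) sX-linked sY-linked Ymid∉X heads≢ =
    HasCycle-intro s (Xmid ++ v ∷ reverse Ymid) length≥2 cycle! cycle-linked
    where
    X-split : s ∷ Xmid ++ v ∷ Xrest ≡ (s ∷ Xmid ++ [ v ]) ++ Xrest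
    X-split = cong (s ∷_) (sym (++-assoc Xmid [ v ] Xrest))
    Y-split : s ∷ Ymid ++ v ∷ Yrest ≡ (s ∷ Ymid ++ [ v ]) ++ Yrest
    Y-split = cong (s ∷_) (sym (++-assoc Ymid [ v ] Yrest))
    way-back : reverse (s ∷ Ymid ++ [ v ]) ≡ v ∷ reverse Ymid ++ [ s ]
    way-back = trans (reverse-++ (s ∷ Ymid) [ v ]) (cong (v ∷_) (unfold-reverse s Ymid))
    cycle-linked : Linked A ((s ∷ Xmid ++ v ∷ reverse Ymid) ++ [ s ])
    cycle-linked = subst (Linked A) (cong (s ∷_) (sym (++-assoc Xmid (v ∷ reverse Ymid) [ s ])))
      (Linked-glue (s ∷ Xmid)
        (Linked-++⁻ˡ (s ∷ Xmid ++ [ v ]) (subst (Linked A) X-split sX-linked))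
        (subst (Linked A) way-back
          (Linked-reverse A-sym (Linked-++⁻ˡ (s ∷ Ymid ++ [ v ]) (subst (Linked A) Y-split sY-linked)))))
    disjoint : ∀ {u} → u ∈ s ∷ Xmid ++ [ v ] × u ∈ reverse Ymid → ⊥
    disjoint {u} (u∈sXv , u∈rYmid) with subst (u ∈_) (sym X-split) (∈-++⁺ˡ u∈sXv)
    ... | here refl = Unique.Unique[x∷xs]⇒x∉xs sY! (∈-++⁺ˡ (Any.reverse⁻ {xs = Ymid} u∈rYmid))
    ... | there u∈X = All.lookup Ymid∉X (Any.reverse⁻ {xs = Ymid} u∈rYmid) u∈X
    cycle! : Unique (s ∷ Xmid ++ v ∷ reverse Ymid)
    cycle! = subst Unique (cong (s ∷_) (++-assoc Xmid [ v ] (reverse Ymid)))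
      (Unique.++⁺ (Unique-++⁻ˡ (s ∷ Xmid ++ [ v ]) (subst Unique X-split sX!))
                  (Unique-reverse (Unique-++⁻ˡ Ymid Y!))
                  disjoint)
    length≥2 : 2 ≤ length (Xmid ++ v ∷ reverse Ymid)
    length≥2 = not-both-empty Xmid Ymid heads≢
      where
      not-both-empty : ∀ xs ys → head (xs ++ v ∷ Xrest) ≢ head (ys ++ v ∷ Yrest) → 2 ≤ length (xs ++ v ∷ reverse ys)
      not-both-empty []       []       heads≢ = ⊥-elim (heads≢ refl)
      not-both-empty []       (y ∷ ys) _      = s≤s (subst (1 ≤_) (sym (length-reverse (y ∷ ys))) (s≤s z≤n))
      not-both-empty (x ∷ xs) _        _      = s≤s (subst (1 ≤_) (sym (length-++-sucʳ xs v _)) (s≤s z≤n))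

  diverging-paths⇒cycle : ∀ {s w X Y} → Unique (s ∷ X) → Unique (s ∷ Y) → Linked A (s ∷ X) → Linked A (s ∷ Y) →
                          last X ≡ just w → last Y ≡ just w → head X ≢ head Y → HasCycle A
  diverging-paths⇒cycle {s} {w} {X} {Y} sX! sY! sX-linked sY-linked X-ends Y-ends heads≢
    with first∈-view X Y (lose (last-∈ Y-ends) (last-∈ X-ends))
  ... | First._++_∷_ {Ymid} {v} Ymid∉X v∈X Yrest with ∈-∃++ v∈X
  ...   | Xmid , Xrest , refl = meeting⇒cycle s v Xmid Xrest Ymid Yrest sX! sY! sX-linked sY-linked Ymid∉X heads≢

module _ {n} (F : EdgeList n) where

  Fsignature-∈F : ∀ {a x p} → InF F a x → Fsignature F (a ∷ x ∷ p) ≡ (a , x) ∷ Fsignature F (x ∷ p)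
  Fsignature-∈F = filter-accept (InF? F)

  Fsignature-∉F : ∀ {a x p} → ¬ InF F a x → Fsignature F (a ∷ x ∷ p) ≡ Fsignature F (x ∷ p)
  Fsignature-∉F = filter-reject (InF? F)

  Fsignature-cancelˡ : ∀ a x p q → Fsignature F (a ∷ x ∷ p) ≡ Fsignature F (a ∷ x ∷ q) →
                       Fsignature F (x ∷ p) ≡ Fsignature F (x ∷ q)
  Fsignature-cancelˡ a x p q eq with InF? F (a , x)
  ... | yes ax∈F = ∷-injectiveʳ (trans (sym (Fsignature-∈F ax∈F)) (trans eq (Fsignature-∈F ax∈F)))
  ... | no  ax∉F = trans (sym (Fsignature-∉F ax∉F)) (trans eq (Fsignature-∉F ax∉F))

  Fsignature-start-∈ : ∀ p {e es} → Fsignature F p ≡ e ∷ es → proj₁ e ∈ p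
  Fsignature-start-∈ p eq = All.head (subst (All _) eq (All.filter⁺ (InF? F) (All.map proj₁ (steps-∈ p))))

  Fsignature-oriented : ∀ {p} → Unique p → OrientedSelection F (Fsignature F p)
  Fsignature-oriented {p} p! = All.all-filter (InF? F) (steps p) , AllPairs.filter⁺ (InF? F) (steps-≢ᵘ p!)

  forestPrefix : Fin n → List (Fin n) → List (Fin n)
  forestPrefix x []      = []
  forestPrefix x (v ∷ r) with InF? F (x , v)
  ... | yes _ = []
  ... | no  _ = v ∷ forestPrefix v r

  forestPrefix-++ : ∀ x r → ∃ λ rest → r ≡ forestPrefix x r ++ rest
  forestPrefix-++ x []      = [] , refl
  forestPrefix-++ x (v ∷ r) with InF? F (x , v)
  ... | yes _ = v ∷ r , refl
  ... | no  _ = Product.map₂ (cong (v ∷_)) (forestPrefix-++ v r)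

  forestPrefix-unique : ∀ {a x r} → Unique (a ∷ x ∷ r) → Unique (a ∷ x ∷ forestPrefix x r)
  forestPrefix-unique {a} {x} {r} axr! with forestPrefix-++ x r
  ... | rest , r≡prefix++rest =
    Unique-++⁻ˡ (a ∷ x ∷ forestPrefix x r) (subst (λ r′ → Unique (a ∷ x ∷ r′)) r≡prefix++rest axr!)

  forestPrefix-linked : ∀ {E : Digraph n} {x r} → Linked E (x ∷ r) → Linked (AdjUminusF E F) (x ∷ forestPrefix x r)
  forestPrefix-linked {x = x} {[]}    _        = [-]
  forestPrefix-linked {x = x} {v ∷ r} (e ∷ es) with InF? F (x , v)
  ... | yes _    = [-]
  ... | no  xv∉F = (inj₁ e , xv∉F) ∷ forestPrefix-linked es

  forestExit : List (Fin n × Fin n) → Maybe (Fin n) → Maybe (Fin n)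
  forestExit []            end = end
  forestExit ((u , _) ∷ _) _   = just u

  last-forestPrefix : ∀ x r → last (x ∷ forestPrefix x r) ≡ forestExit (Fsignature F (x ∷ r)) (last (x ∷ r))
  last-forestPrefix x []      = refl
  last-forestPrefix x (v ∷ r) with InF? F (x , v)
  ... | yes xv∈F = cong (λ sig → forestExit sig (last (v ∷ r))) (sym (Fsignature-∈F xv∈F))
  ... | no  xv∉F =
    trans (last-forestPrefix v r) (cong (λ sig → forestExit sig (last (v ∷ r))) (sym (Fsignature-∉F xv∉F)))

  AdjUminusF-sym : ∀ {E : Digraph n} {x y} → AdjUminusF E F x y → AdjUminusF E F y x
  AdjUminusF-sym (xy∈U , xy∉F) = Sum.swap xy∈U , xy∉F ∘ Sum.swap

-- Injectivity of F-signatures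

module _ {n} {E : Digraph n} {F : EdgeList n} (acyclic : ¬ HasCycle (AdjUminusF E F)) where

  -- Both paths stay in U − F up to the same vertex, so different first steps would close a cycle there.
  forest-step-determined : ∀ {a x y p q} → ¬ InF F a x → ¬ InF F a y →
                           Unique (a ∷ x ∷ p) → Unique (a ∷ y ∷ q) → Linked E (a ∷ x ∷ p) → Linked E (a ∷ y ∷ q) →
                           last (x ∷ p) ≡ last (y ∷ q) → Fsignature F (a ∷ x ∷ p) ≡ Fsignature F (a ∷ y ∷ q) → x ≡ y
  forest-step-determined {a} {x} {y} {p} {q} ax∉F ay∉F axp! ayq! (ax ∷ xp-linked) (ay ∷ yq-linked) lasts sigs
    with x Fin.≟ y
  ... | yes x≡y = x≡y
  ... | no  x≢y = ⊥-elim (acyclic (diverging-paths⇒cycle (AdjUminusF-sym F)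
          (forestPrefix-unique F axp!) (forestPrefix-unique F ayq!)
          ((inj₁ ax , ax∉F) ∷ forestPrefix-linked F xp-linked) ((inj₁ ay , ay∉F) ∷ forestPrefix-linked F yq-linked)
          (proj₂ x-exit) (trans (sym same-exit) (proj₂ x-exit)) (x≢y ∘ just-injective)))
    where
    x-exit : ∃ λ w → last (x ∷ forestPrefix F x p) ≡ just w
    x-exit = last-∷ x (forestPrefix F x p)
    tail-sigs : Fsignature F (x ∷ p) ≡ Fsignature F (y ∷ q)
    tail-sigs = trans (sym (Fsignature-∉F F ax∉F)) (trans sigs (Fsignature-∉F F ay∉F))
    same-exit : last (x ∷ forestPrefix F x p) ≡ last (y ∷ forestPrefix F y q)
    same-exit = begin
      last (x ∷ forestPrefix F x p)                        ≡⟨ last-forestPrefix F x p ⟩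
      forestExit F (Fsignature F (x ∷ p)) (last (x ∷ p))   ≡⟨ cong₂ (forestExit F) tail-sigs lasts ⟩
      forestExit F (Fsignature F (y ∷ q)) (last (y ∷ q))   ≡⟨ last-forestPrefix F y q ⟨
      last (y ∷ forestPrefix F y q)                        ∎
      where open ≡-Reasoning

  -- A first step in F starts the signature with an edge leaving a;
  -- the other path never returns to a, so its signature has no such edge.
  first-step-determined : ∀ {a x y p q} →
                          Unique (a ∷ x ∷ p) → Unique (a ∷ y ∷ q) → Linked E (a ∷ x ∷ p) → Linked E (a ∷ y ∷ q) →
                          last (x ∷ p) ≡ last (y ∷ q) → Fsignature F (a ∷ x ∷ p) ≡ Fsignature F (a ∷ y ∷ q) → x ≡ y
  first-step-determined {a} {x} {y} {p} {q} axp! ayq! axp-linked ayq-linked lasts sigs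
    with InF? F (a , x) | InF? F (a , y)
  ... | yes ax∈F | yes ay∈F =
    cong proj₂ (∷-injectiveˡ (trans (sym (Fsignature-∈F F ax∈F)) (trans sigs (Fsignature-∈F F ay∈F))))
  ... | yes ax∈F | no  ay∉F = ⊥-elim (Unique.Unique[x∷xs]⇒x∉xs ayq!
          (Fsignature-start-∈ F (y ∷ q) (trans (sym (Fsignature-∉F F ay∉F)) (trans (sym sigs) (Fsignature-∈F F ax∈F)))))
  ... | no  ax∉F | yes ay∈F = ⊥-elim (Unique.Unique[x∷xs]⇒x∉xs axp!
          (Fsignature-start-∈ F (x ∷ p) (trans (sym (Fsignature-∉F F ax∉F)) (trans sigs (Fsignature-∈F F ay∈F)))))
  ... | no  ax∉F | no  ay∉F =
    forest-step-determined ax∉F ay∉F axp! ayq! axp-linked ayq-linked lasts sigs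

  Fsignature-injective : ∀ {p q} → Unique p → Unique q → Linked E p → Linked E q →
                         head p ≡ head q → last p ≡ last q → Fsignature F p ≡ Fsignature F q → p ≡ q
  Fsignature-injective {[]}        {[]}         _ _ _ _ _    _ _ = refl
  Fsignature-injective {[]}        {_ ∷ _}      _ _ _ _ ()   _ _
  Fsignature-injective {_ ∷ _}     {[]}         _ _ _ _ ()   _ _
  Fsignature-injective {a ∷ []}    {.a ∷ []}    _ _ _ _ refl _ _ = refl
  Fsignature-injective {a ∷ []}    {.a ∷ _ ∷ _} _    ayq! _ _ refl lasts _ =
    ⊥-elim (Unique.Unique[x∷xs]⇒x∉xs ayq! (last-∈ (sym lasts)))
  Fsignature-injective {a ∷ _ ∷ _} {.a ∷ []}    axp! _    _ _ refl lasts _ =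
    ⊥-elim (Unique.Unique[x∷xs]⇒x∉xs axp! (last-∈ lasts))
  Fsignature-injective {a ∷ x ∷ p} {.a ∷ y ∷ q}
                       axp!@(_ ∷ xp!) ayq!@(_ ∷ yq!) axp-linked@(_ ∷ xp-linked) ayq-linked@(_ ∷ yq-linked) refl lasts sigs
    with first-step-determined axp! ayq! axp-linked ayq-linked lasts sigs
  ... | refl =
    cong (a ∷_) (Fsignature-injective xp! yq! xp-linked yq-linked refl lasts (Fsignature-cancelˡ F a x p q sigs))

lemma8 : (n : ℕ) (E : Digraph n) (s t : Fin n) (F : EdgeList n) →
         IsFeedbackEdgeSet E F →
         ((ps : List (List (Fin n))) → Unique ps → All (SimplePath E s t) ps →
            length ps ≤ N (length F))
         × (N (length F) ≤ (2 * length F + 1) ^ length F)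
         × ((p q : List (Fin n)) → SimplePath E s t p → SimplePath E s t q →
            Fsignature F p ≡ Fsignature F q → p ≡ q)
lemma8 n E s t F (_ , acyclic) = path-count , N≤[2f+1]^f (length F) , signature-determines-path
  where
  signature-determines-path : (p q : List (Fin n)) → SimplePath E s t p → SimplePath E s t q →
                              Fsignature F p ≡ Fsignature F q → p ≡ q
  signature-determines-path p q (p! , p-linked , p-head , p-last) (q! , q-linked , q-head , q-last) =
    Fsignature-injective acyclic p! q! p-linked q-linked (trans p-head (sym q-head)) (trans p-last (sym q-last))

  path-count : (ps : List (List (Fin n))) → Unique ps → All (SimplePath E s t) ps → length ps ≤ N (length F)
  path-count ps ps! ps-simple = begin
    length ps
      ≤⟨ injectiveOn⇒length≤ (Fsignature F) (signature-determines-path _ _) ps! ps-simple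
           (λ (p! , _) → orientedSelections-complete (length F) F _ ≤-refl (Fsignature-oriented F p!)) ⟩
    length (orientedSelections (length F) F)
      ≤⟨ length-orientedSelections (length F) F ≤-refl ⟩
    N (length F)
      ∎
    where open ≤-Reasoning
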